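{- Let $G$ be a graph and $\alpha(G)$ its independence number. (a) For every integer $b\geq 1$, $\phi^0_b(G)\geq\phi(G)$; moreover $\lim_{b\to\infty}\phi^0_b(G)=\phi(G)$. (b) For all integers $a'\geq a\geq 0$ and $b'\geq b\geq 1$, $\phi^a_b(G)\geq \phi^{a'}_{b'}(G)$. (c) For all integers $a\geq 0$ and $b\geq 1$, $\phi^a_b(G)\geq \dfrac{|V(G)|-a\,\alpha(G)}{\bar{\alpha}(G)}$.
   Context: All graphs are finite and simple; $N(v)$ is the open neighborhood of $v$. An independent set $F$ of $G$ is a free independent set if it is contained in at least two distinct maximal independent sets of $G$. An edge $e=uv$ supports $F$ if $F\cap(N(u)\cup N(v))=\emptyset$; $F$ is free iff it is independent and supported by some edge. The free chromatic number $\phi(G)$ is the minimum $t$ such that $V(G)$ can be partitioned into $t$ free independent sets ($\infty$ if no such partition exists). $\bar{\alpha}(G)$ is the maximum size of a free independent set of $G$. For integers $a\geq 0$, $b\geq 1$, the $(a,b)$-free chromatic number $\phi^a_b(G)$ is the minimum natural number $t$ such that: (1) $V(G)$ can be partitioned into independent sets $V_1,\ldots,V_t$ such that $V_1,\ldots,V_{t-a}$ are free independent sets (i.e., all but at most $a$ of the classes are free); and (2) there are edges $e_1,\ldots,e_{t-a}$ (not necessarily distinct) with $e_i$ supporting $V_i$ for each $i$, such that for every vertex $v$ the number of indices $i\in\{1,\ldots,t-a\}$ with $e_i$ incident to $v$ is at most $b$. If no such $t$ exists, $\phi^a_b(G)=\infty$. -}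

module Defs where

open import Data.Nat using (ℕ; _≤_; _∸_; _<?_)
open import Data.Fin using (Fin; toℕ; _≟_)
open import Data.Fin.Subset using (Subset; _∈_; _∉_; _⊆_; ∣_∣)
open import Data.Bool using (Bool; true; false)
open import Data.Vec using (tabulate)
open import Data.List using (length; filter)
open import Data.List.Base using (List)
open import Data.Fin.Base using ()
open import Data.List using (allFin)
open import Data.Product using (Σ; ∃; ∃-syntax; _×_; _,_; proj₁; proj₂)
open import Data.Sum using (_⊎_)
open import Relation.Nullary using (¬_; Dec)
open import Relation.Nullary.Decidable using (⌊_⌋; _×-dec_; _⊎-dec_)
open import Relation.Binary.PropositionalEquality using (_≡_; _≢_)

record Graph (n : ℕ) : Set where
  field
    adj   : Fin n → Fin n → Bool
    sym   : ∀ u v → adj u v ≡ adj v u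
    irrefl : ∀ v → adj v v ≡ false

open Graph public

Adj : ∀ {n} → Graph n → Fin n → Fin n → Set
Adj G u v = adj G u v ≡ true

Independent : ∀ {n} → Graph n → Subset n → Set
Independent G S = ∀ u v → u ∈ S → v ∈ S → ¬ Adj G u v

MaximalIndependent : ∀ {n} → Graph n → Subset n → Set
MaximalIndependent G S =
  Independent G S × (∀ T → Independent G T → S ⊆ T → T ≡ S)

Free : ∀ {n} → Graph n → Subset n → Set
Free G F = Independent G F ×
  (∃[ M₁ ] ∃[ M₂ ] (MaximalIndependent G M₁ × MaximalIndependent G M₂ ×
                     F ⊆ M₁ × F ⊆ M₂ × M₁ ≢ M₂))

Supports : ∀ {n} → Graph n → Fin n → Fin n → Subset n → Set
Supports G u v F = Adj G u v × (∀ w → w ∈ F → ¬ Adj G w u × ¬ Adj G w v)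

-- Colour classes of a colouring c : Fin n → Fin t (a partition of V(G)
-- into t, possibly empty, classes)

Class : ∀ {n t} → (Fin n → Fin t) → Fin t → Subset n
Class c i = tabulate (λ v → ⌊ c v ≟ i ⌋)

FreeColorable : ∀ {n} → Graph n → ℕ → Set
FreeColorable {n} G t = Σ (Fin n → Fin t) λ c → ∀ i → Free G (Class c i)

Load : ∀ {n} t → ℕ → (Fin t → Fin n × Fin n) → Fin n → ℕ
Load t a e v = length (filter
  (λ i → (toℕ i <? (t ∸ a)) ×-dec ((proj₁ (e i) ≟ v) ⊎-dec (proj₂ (e i) ≟ v)))
  (allFin t))

-- Conditions (1) and (2) in the definition of φ^a_b with t classes:
-- classes V_i with toℕ i < t ∸ a are free and supported by the edge e i,
-- and each vertex is incident to at most b of the edges e_i (i < t ∸ a).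
ABColorable : ∀ {n} → Graph n → ℕ → ℕ → ℕ → Set
ABColorable {n} G a b t =
  Σ (Fin n → Fin t) λ c →
  Σ (Fin t → Fin n × Fin n) λ e →
    (∀ i → toℕ i Data.Nat.< t ∸ a →
       Free G (Class c i) ×
       Supports G (proj₁ (e i)) (proj₂ (e i)) (Class c i))
    × (∀ i → Independent G (Class c i))
    × (∀ v → Load t a e v ≤ b)

data ℕ∞ : Set where
  fin : ℕ → ℕ∞
  ∞   : ℕ∞

data _≤∞_ : ℕ∞ → ℕ∞ → Set where
  fin≤fin : ∀ {m n} → m ≤ n → fin m ≤∞ fin n
  _≤∞∞    : ∀ x → x ≤∞ ∞

IsMin : (ℕ → Set) → ℕ∞ → Set
IsMin P (fin t) = P t × (∀ s → P s → t ≤ s)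
IsMin P ∞       = ∀ s → ¬ P s

IsMaxSize : ∀ {n} → (Subset n → Set) → ℕ → Set
IsMaxSize P k = (∃[ S ] (P S × ∣ S ∣ ≡ k)) × (∀ S → P S → ∣ S ∣ ≤ k)

IsPhi : ∀ {n} → Graph n → ℕ∞ → Set
IsPhi G = IsMin (FreeColorable G)

IsPhiAB : ∀ {n} → Graph n → ℕ → ℕ → ℕ∞ → Set
IsPhiAB G a b = IsMin (ABColorable G a b)

IsAlpha : ∀ {n} → Graph n → ℕ → Set
IsAlpha G = IsMaxSize (Independent G)

IsAlphaBar : ∀ {n} → Graph n → ℕ → Set
IsAlphaBar G = IsMaxSize (Free G)

-- A free set F lies in two distinct maximal independent sets M₁ ≠ M₂; a vertex
-- w ∈ M₁ ∖ M₂ has, by maximality of M₂, a neighbour u ∈ M₂, and F avoids N(w) and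
-- N(u), so wu supports F.  Hence free colourings with t ≤ b classes are exactly
-- (0,b)-colourings, which gives (a); weakening a and b only weakens conditions (1)
-- and (2), which gives (b).  For (c), the t − a constrained classes have at most
-- ᾱ(G) vertices and the remaining at most a classes at most α(G).
module Submission where

open import Defs
open import Data.Nat using (ℕ; _≤_; _+_; _*_)
open import Data.Product using (_×_; ∃-syntax)
open import Relation.Binary.PropositionalEquality using (_≡_)

open import Data.Nat.Properties hiding (_≟_)
open import Algebra.Properties.CommutativeMonoid.Sum +-0-commutativeMonoid using (sum)
open import Data.Bool using (true) renaming (_≟_ to _≟ᵇ_)
open import Data.Empty using (⊥-elim)
open import Data.Fin using (Fin; zero; suc; toℕ; _≟_)
open import Data.Fin.Properties using (toℕ<n; any?)
open import Data.Fin.Subset using (_∈_; _∉_; _⊆_; ∣_∣; _∪_; ⁅_⁆)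
open import Data.Fin.Subset.Properties using (_∈?_; x∈p∪q⁻; x∈p∪q⁺; x∈⁅y⁆⇒x≡y; x∈⁅x⁆; ∣p∣≤∣x∷p∣)
open import Data.List using (allFin)
open import Data.List.Properties using (length-filter; length-tabulate)
open import Data.List.Relation.Binary.Sublist.Propositional using (⊆-refl)
open import Data.List.Relation.Binary.Sublist.Propositional.Properties using (filter⁺; length-mono-≤)
open import Data.Nat using (suc; _∸_; _<_; _<?_; z≤n; s≤s)
open import Data.Product using (_,_; proj₁; proj₂)
open import Data.Sum using (_⊎_; inj₁; inj₂)
open import Function using (_∘_)
open import Relation.Nullary using (¬_; Dec; yes; no; ¬?)
open import Relation.Nullary.Decidable using (⌊_⌋; _×-dec_; _⊎-dec_)
open import Relation.Binary.PropositionalEquality using (refl; trans; cong; subst; _≢_)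
  renaming (sym to ≡-sym)

adj? : ∀ {n} (G : Graph n) u v → Dec (Adj G u v)
adj? G u v = adj G u v ≟ᵇ true

¬Adj-refl : ∀ {n} (G : Graph n) v → ¬ Adj G v v
¬Adj-refl G v a with trans (≡-sym a) (irrefl G v)
... | ()

∪⁅⁆-independent : ∀ {n} (G : Graph n) {S} w → Independent G S →
                  (∀ u → u ∈ S → ¬ Adj G w u) → Independent G (S ∪ ⁅ w ⁆)
∪⁅⁆-independent G {S} w indS w≁S x y x∈ y∈ x~y
  with x∈p∪q⁻ S ⁅ w ⁆ x∈ | x∈p∪q⁻ S ⁅ w ⁆ y∈
... | inj₁ x∈S | inj₁ y∈S = indS x y x∈S y∈S x~y
... | inj₁ x∈S | inj₂ y∈w rewrite x∈⁅y⁆⇒x≡y w y∈w = w≁S x x∈S (trans (Graph.sym G w x) x~y)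
... | inj₂ x∈w | inj₁ y∈S rewrite x∈⁅y⁆⇒x≡y w x∈w = w≁S y y∈S x~y
... | inj₂ x∈w | inj₂ y∈w rewrite x∈⁅y⁆⇒x≡y w x∈w | x∈⁅y⁆⇒x≡y w y∈w = ¬Adj-refl G w x~y

maximal-dominating : ∀ {n} (G : Graph n) {M} → MaximalIndependent G M →
                     ∀ w → w ∉ M → ∃[ u ] (u ∈ M × Adj G w u)
maximal-dominating G {M} (indM , maxM) w w∉M with any? (λ u → (u ∈? M) ×-dec adj? G w u)
... | yes found = found
... | no ¬found = ⊥-elim (w∉M (subst (w ∈_) M∪w≡M (x∈p∪q⁺ (inj₂ (x∈⁅x⁆ w)))))
  where
  M∪w≡M : M ∪ ⁅ w ⁆ ≡ M
  M∪w≡M = maxM _ (∪⁅⁆-independent G w indM (λ u u∈M w~u → ¬found (u , u∈M , w~u)))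
                 (λ u∈M → x∈p∪q⁺ (inj₁ u∈M))

maximal-≢⇒∃∈∉ : ∀ {n} (G : Graph n) {M₁ M₂} → MaximalIndependent G M₁ → Independent G M₂ →
                M₁ ≢ M₂ → ∃[ w ] (w ∈ M₁ × w ∉ M₂)
maximal-≢⇒∃∈∉ G {M₁} {M₂} (_ , maxM₁) indM₂ M₁≢M₂
  with any? (λ w → (w ∈? M₁) ×-dec ¬? (w ∈? M₂))
... | yes found = found
... | no ¬found = ⊥-elim (M₁≢M₂ (≡-sym (maxM₁ M₂ indM₂ M₁⊆M₂)))
  where
  M₁⊆M₂ : M₁ ⊆ M₂
  M₁⊆M₂ {x} x∈M₁ with x ∈? M₂
  ... | yes x∈M₂ = x∈M₂
  ... | no x∉M₂ = ⊥-elim (¬found (x , x∈M₁ , x∉M₂))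

free⇒supported : ∀ {n} (G : Graph n) {F} → Free G F → ∃[ u ] ∃[ v ] Supports G u v F
free⇒supported G (_ , M₁ , M₂ , max₁ , max₂ , F⊆M₁ , F⊆M₂ , M₁≢M₂)
  with maximal-≢⇒∃∈∉ G max₁ (proj₁ max₂) M₁≢M₂
... | w , w∈M₁ , w∉M₂ with maximal-dominating G max₂ w w∉M₂
...   | u , u∈M₂ , w~u = w , u , w~u , λ f f∈F →
          (λ f~w → proj₁ max₁ f w (F⊆M₁ f∈F) w∈M₁ f~w) ,
          (λ f~u → proj₁ max₂ f u (F⊆M₂ f∈F) u∈M₂ f~u)

≤∞-antisym : ∀ {x y} → x ≤∞ y → y ≤∞ x → x ≡ y
≤∞-antisym (fin≤fin m≤n) (fin≤fin n≤m) = cong fin (≤-antisym m≤n n≤m)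
≤∞-antisym (∞ ≤∞∞)       (.∞ ≤∞∞)      = refl

isMin-least : ∀ {P x t} → IsMin P x → P t → x ≤∞ fin t
isMin-least {x = fin s} (_ , least) Pt = fin≤fin (least _ Pt)
isMin-least {x = ∞}     none        Pt = ⊥-elim (none _ Pt)

isMin-antitone : ∀ {P Q x y} → (∀ t → P t → Q t) → IsMin P x → IsMin Q y → y ≤∞ x
isMin-antitone {x = fin s} P⇒Q (Ps , _) minQ = isMin-least minQ (P⇒Q s Ps)
isMin-antitone {x = ∞}     P⇒Q _        _    = _ ≤∞∞

Load≤t : ∀ {n} t a (e : Fin t → Fin n × Fin n) v → Load t a e v ≤ t
Load≤t t a e v = ≤-trans (length-filter _ (allFin t)) (≤-reflexive (length-tabulate (λ i → i)))

Load-antitone : ∀ {n} t {a a′} (e : Fin t → Fin n × Fin n) v → a ≤ a′ → Load t a′ e v ≤ Load t a e v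
Load-antitone t {a} {a′} e v a≤a′ = length-mono-≤ (filter⁺ (counted? a′) (counted? a)
  (λ { refl (i<t∸a′ , incident) → ≤-trans i<t∸a′ (∸-monoʳ-≤ t a≤a′) , incident }) (⊆-refl {x = allFin t}))
  where
  counted? : ∀ a i → Dec (toℕ i < t ∸ a × (proj₁ (e i) ≡ v ⊎ proj₂ (e i) ≡ v))
  counted? a i = (toℕ i <? (t ∸ a)) ×-dec ((proj₁ (e i) ≟ v) ⊎-dec (proj₂ (e i) ≟ v))

ab0⇒free : ∀ {n} (G : Graph n) b t → ABColorable G 0 b t → FreeColorable G t
ab0⇒free G b t (c , _ , free , _) = c , λ i → proj₁ (free i (toℕ<n i))

free⇒ab0 : ∀ {n} (G : Graph n) b t → t ≤ b → FreeColorable G t → ABColorable G 0 b t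
free⇒ab0 G b t t≤b (c , free) =
  c , edge , (λ i _ → free i , proj₂ (proj₂ (supported i))) , (proj₁ ∘ free) ,
  λ v → ≤-trans (Load≤t t 0 edge v) t≤b
  where
  supported : ∀ i → ∃[ u ] ∃[ v ] Supports G u v (Class c i)
  supported i = free⇒supported G (free i)
  edge : Fin t → Fin _ × Fin _
  edge i = proj₁ (supported i) , proj₁ (proj₂ (supported i))

ab-weaken : ∀ {n} (G : Graph n) {a a′ b b′} t → a ≤ a′ → b ≤ b′ →
            ABColorable G a b t → ABColorable G a′ b′ t
ab-weaken G t a≤a′ b≤b′ (c , e , free , indep , load) =
  c , e , (λ i i<t∸a′ → free i (≤-trans i<t∸a′ (∸-monoʳ-≤ t a≤a′))) , indep ,
  λ v → ≤-trans (Load-antitone t e v a≤a′) (≤-trans (load v) b≤b′)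

sum-mono-≤ : ∀ {t} {f g : Fin t → ℕ} → (∀ i → f i ≤ g i) → sum f ≤ sum g
sum-mono-≤ {ℕ.zero} f≤g = z≤n
sum-mono-≤ {suc t}  f≤g = +-mono-≤ (f≤g zero) (sum-mono-≤ (f≤g ∘ suc))

sum-mono-< : ∀ {t} {f g : Fin t → ℕ} → (∀ i → f i ≤ g i) → ∀ j → f j < g j → sum f < sum g
sum-mono-< f≤g zero    fj<gj = +-mono-<-≤ fj<gj (sum-mono-≤ (f≤g ∘ suc))
sum-mono-< f≤g (suc j) fj<gj = +-mono-≤-< (f≤g zero) (sum-mono-< (f≤g ∘ suc) j fj<gj)

sum≤t*B : ∀ {t} (f : Fin t → ℕ) {B} → (∀ i → f i ≤ B) → sum f ≤ t * B
sum≤t*B {ℕ.zero} f f≤B = z≤n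
sum≤t*B {suc t}  f f≤B = +-mono-≤ (f≤B zero) (sum≤t*B (f ∘ suc) (f≤B ∘ suc))

sum≤k*A+[t∸k]*B : ∀ {t} k (f : Fin t → ℕ) {A B} →
                  (∀ i → toℕ i < k → f i ≤ A) → (∀ i → f i ≤ B) → sum f ≤ k * A + (t ∸ k) * B
sum≤k*A+[t∸k]*B {ℕ.zero} k        f f≤A f≤B = z≤n
sum≤k*A+[t∸k]*B {suc t}  ℕ.zero   f f≤A f≤B = sum≤t*B f f≤B
sum≤k*A+[t∸k]*B {suc t}  (suc k)  f {A} {B} f≤A f≤B = begin
  f zero + sum (f ∘ suc)          ≤⟨ +-mono-≤ (f≤A zero (s≤s z≤n)) tail-bound ⟩
  A + (k * A + (t ∸ k) * B)       ≡⟨ ≡-sym (+-assoc A (k * A) ((t ∸ k) * B)) ⟩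
  suc k * A + (suc t ∸ suc k) * B ∎
  where
  open ≤-Reasoning
  tail-bound : sum (f ∘ suc) ≤ k * A + (t ∸ k) * B
  tail-bound = sum≤k*A+[t∸k]*B k (f ∘ suc) (λ i i<k → f≤A (suc i) (s≤s i<k)) (f≤B ∘ suc)

-- Vertex 0 lies in its own class, so dropping it shrinks the class sizes, strictly at c 0.
n≤∑∣Class∣ : ∀ {n t} (c : Fin n → Fin t) → n ≤ sum (λ i → ∣ Class c i ∣)
n≤∑∣Class∣ {ℕ.zero} c = z≤n
n≤∑∣Class∣ {suc n}  c = ≤-trans (s≤s (n≤∑∣Class∣ (c ∘ suc)))
  (sum-mono-< (λ i → ∣p∣≤∣x∷p∣ ⌊ c zero ≟ i ⌋ (Class (c ∘ suc) i)) (c zero) own-class-grows)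
  where
  own-class-grows : ∣ Class (c ∘ suc) (c zero) ∣ < ∣ Class c (c zero) ∣
  own-class-grows with c zero ≟ c zero
  ... | yes _ = ≤-refl
  ... | no c₀≢c₀ = ⊥-elim (c₀≢c₀ refl)

m∸[m∸n]≤n : ∀ m n → m ∸ (m ∸ n) ≤ n
m∸[m∸n]≤n m n with ≤-total n m
... | inj₁ n≤m = ≤-reflexive (m∸[m∸n]≡n n≤m)
... | inj₂ m≤n = ≤-trans (m∸n≤m m (m ∸ n)) m≤n

φ≤φ⁰ : ∀ {n} (G : Graph n) b x y → IsPhi G x → IsPhiAB G 0 b y → x ≤∞ y
φ≤φ⁰ G b x y φx φ⁰y = isMin-antitone (ab0⇒free G b) φ⁰y φx

φ⁰-eventually-φ : ∀ {n} (G : Graph n) x → IsPhi G x →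
                  ∃[ B ] (∀ b → B ≤ b → ∀ y → IsPhiAB G 0 b y → y ≡ x)
φ⁰-eventually-φ G (fin s) φs@(colorable , _) =
  s , λ b s≤b y φ⁰y → ≤∞-antisym (isMin-least φ⁰y (free⇒ab0 G b s s≤b colorable))
                                  (φ≤φ⁰ G b _ y φs φ⁰y)
φ⁰-eventually-φ G ∞ φ∞ =
  0 , λ b _ y φ⁰y → ≤∞-antisym (y ≤∞∞) (φ≤φ⁰ G b ∞ y φ∞ φ⁰y)

φᵃᵇ-antitone : ∀ {n} (G : Graph n) {a a′ b b′} → a ≤ a′ → b ≤ b′ → ∀ x y →
               IsPhiAB G a b x → IsPhiAB G a′ b′ y → y ≤∞ x
φᵃᵇ-antitone G a≤a′ b≤b′ x y = isMin-antitone (λ t → ab-weaken G t a≤a′ b≤b′)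

φᵃᵇ-lower-bound : ∀ {n} (G : Graph n) a b t α ᾱ → IsPhiAB G a b (fin t) →
                  IsAlpha G α → IsAlphaBar G ᾱ → n ≤ t * ᾱ + a * α
φᵃᵇ-lower-bound {n} G a b t α ᾱ ((c , _ , free , indep , _) , _) (_ , α-max) (_ , ᾱ-max) = begin
  n                                     ≤⟨ n≤∑∣Class∣ c ⟩
  sum (λ i → ∣ Class c i ∣)            ≤⟨ sum≤k*A+[t∸k]*B (t ∸ a) _ free-small indep-small ⟩
  (t ∸ a) * ᾱ + (t ∸ (t ∸ a)) * α      ≤⟨ +-mono-≤ (*-monoˡ-≤ ᾱ (m∸n≤m t a)) (*-monoˡ-≤ α (m∸[m∸n]≤n t a)) ⟩
  t * ᾱ + a * α                         ∎
  where
  open ≤-Reasoning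
  free-small : ∀ i → toℕ i < t ∸ a → ∣ Class c i ∣ ≤ ᾱ
  free-small i i<t∸a = ᾱ-max _ (proj₁ (free i i<t∸a))
  indep-small : ∀ i → ∣ Class c i ∣ ≤ α
  indep-small i = α-max _ (indep i)

mainTheorem6 : ∀ {n} (G : Graph n) →
    (∀ b → 1 ≤ b → ∀ x y → IsPhi G x → IsPhiAB G 0 b y → x ≤∞ y)
    × (∀ x → IsPhi G x → ∃[ B ] (∀ b → B ≤ b → 1 ≤ b → ∀ y → IsPhiAB G 0 b y → y ≡ x))
    × (∀ a a′ b b′ → a ≤ a′ → 1 ≤ b → b ≤ b′ → ∀ x y →
    IsPhiAB G a b x → IsPhiAB G a′ b′ y → y ≤∞ x)
    × (∀ a b → 1 ≤ b → ∀ t α ᾱ → IsPhiAB G a b (fin t) → IsAlpha G α → IsAlphaBar G ᾱ →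
    n ≤ t * ᾱ + a * α)
mainTheorem6 G =
  (λ b _ → φ≤φ⁰ G b) ,
  (λ x φx → let B , stable = φ⁰-eventually-φ G x φx in B , λ b B≤b _ → stable b B≤b) ,
  (λ a a′ b b′ a≤a′ _ b≤b′ → φᵃᵇ-antitone G a≤a′ b≤b′) ,
  (λ a b _ → φᵃᵇ-lower-bound G a b)
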